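{- Let $D=(G,\mathcal{O},w)$ be a weighted oriented graph where $G$ is an $SCQ$ graph, with $Q_G$ a set witnessing this, and let $\mathcal{C}$ be a vertex cover of $D$. Then $|\mathcal{C}|=\tau(G)$ if and only if $|\mathcal{C}\cap V(K)|=|V(K)|-1$ for every $K\in S_G$, $|\mathcal{C}\cap V(C)|=3$ for every $C\in C_G$, and $|\mathcal{C}\cap e|=1$ for every $e\in Q_G$.
   Context: $D=(G,\mathcal{O},w)$ is a weighted oriented graph: $G$ a finite simple graph, $\mathcal{O}$ an orientation of its edges, $w:V(G)\to\mathbb{N}$; a vertex cover of $D$ is a set of vertices containing an endpoint of every edge of $G$, and $\tau(G)$ is the minimum size of a vertex cover. A vertex $v$ is simplicial if $G[N_G[v]]$ is complete; then $G[N_G[v]]$ is a simplex; $S_G$ is the set of simplexes. A basic $5$-cycle is an induced $5$-cycle of $G$ containing no two adjacent vertices both of degree $\ge3$ in $G$; $C_G$ is the set of basic $5$-cycles. An edge $e=\{b,b'\}$ has property (P) if for all edges $\{a,b\},\{a',b'\}\in E(G)$ we have $\{a,a'\}\in E(G)$; a matching has property (P) if all its edges do. $G$ is $SCQ$ if there is $Q_G$, empty or a matching of $G$ with property (P), such that $\{V(H)\mid H\in S_G\cup C_G\cup Q_G\}$ is a partition of $V(G)$. -}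

module Defs where

open import Data.Nat using (ℕ; zero; suc; _∸_; _⊓_)
open import Data.Bool using (Bool; true; false; _∧_; _∨_; not; if_then_else_)
open import Data.Fin using (Fin; _≟_)
open import Data.Fin.Subset using (Subset; _∈_; _∉_; _∪_; ⁅_⁆; ∣_∣)
open import Data.Vec using (Vec; []; _∷_; tabulate; lookup)
open import Data.List using (List; []; _∷_; map; filter; foldr; _++_)
open import Data.List.Membership.Propositional renaming (_∈_ to _∈ₗ_)
open import Data.Product using (Σ; ∃; _×_; _,_; proj₁; proj₂)
open import Data.Sum using (_⊎_)
open import Function.Definitions using (Injective)
open import Relation.Nullary using (¬_)
open import Relation.Nullary.Decidable using (⌊_⌋)
open import Relation.Binary.PropositionalEquality using (_≡_; _≢_)

record Graph (n : ℕ) : Set where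
  field
    adj     : Fin n → Fin n → Bool
    sym     : ∀ u v → adj u v ≡ adj v u
    irrefl  : ∀ u → adj u u ≡ false

open Graph public

Edge : ∀ {n} → Graph n → Fin n → Fin n → Set
Edge G u v = adj G u v ≡ true

record Orientation {n : ℕ} (G : Graph n) : Set where
  field
    arc      : Fin n → Fin n → Bool
    covers   : ∀ u v → (arc u v ∨ arc v u) ≡ adj G u v
    antisym  : ∀ u v → arc u v ≡ true → arc v u ≡ false

record WOGraph (n : ℕ) : Set where
  field
    graph  : Graph n
    orient : Orientation graph
    weight : Fin n → ℕ

IsVertexCover : ∀ {n} → Graph n → Subset n → Set
IsVertexCover G C = ∀ u v → Edge G u v → u ∈ C ⊎ v ∈ C

-- Boolean version, used only to compute τ by exhaustive enumeration.
allB : ∀ {n} → (Fin n → Bool) → Bool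
allB {n} p = Data.Vec.foldr (λ _ → Bool) _∧_ true (tabulate p)
  where import Data.Vec

isVertexCoverᵇ : ∀ {n} → Graph n → Subset n → Bool
isVertexCoverᵇ G C =
  allB (λ u → allB (λ v → not (adj G u v) ∨ lookup C u ∨ lookup C v))

allSubsets : ∀ n → List (Subset n)
allSubsets zero    = [] ∷ []
allSubsets (suc n) = map (true ∷_) (allSubsets n) ++ map (false ∷_) (allSubsets n)

-- τ(G): the minimum size of a vertex cover of G
-- (minimum over all vertex covers; the full vertex set, of size n, is one).
τ : ∀ {n} → Graph n → ℕ
τ {n} G = foldr _⊓_ n (map ∣_∣ (filter (λ C → isVertexCoverᵇ G C Data.Bool.≟ true) (allSubsets n)))
  where import Data.Bool

N[_]_ : ∀ {n} → Fin n → Graph n → Subset n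
N[ v ] G = tabulate (λ u → ⌊ u ≟ v ⌋ ∨ adj G v u)

N_ : ∀ {n} → Graph n → Fin n → Subset n
N_ G v = tabulate (adj G v)

deg : ∀ {n} → Graph n → Fin n → ℕ
deg G v = ∣ N_ G v ∣

IsClique : ∀ {n} → Graph n → Subset n → Set
IsClique G S = ∀ u u' → u ∈ S → u' ∈ S → u ≢ u' → Edge G u u'

IsSimplicial : ∀ {n} → Graph n → Fin n → Set
IsSimplicial G v = IsClique G (N[ v ] G)

-- K ∈ S_G, simplexes identified with their vertex sets V(K):
-- V(K) = N_G[v] for some simplicial vertex v.
IsSimplex : ∀ {n} → Graph n → Subset n → Set
IsSimplex G K = ∃ λ v → IsSimplicial G v × K ≡ N[ v ] G

suc5 : Fin 5 → Fin 5
suc5 Fin.zero = Fin.suc Fin.zero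
suc5 (Fin.suc Fin.zero) = Fin.suc (Fin.suc Fin.zero)
suc5 (Fin.suc (Fin.suc Fin.zero)) = Fin.suc (Fin.suc (Fin.suc Fin.zero))
suc5 (Fin.suc (Fin.suc (Fin.suc Fin.zero))) = Fin.suc (Fin.suc (Fin.suc (Fin.suc Fin.zero)))
suc5 (Fin.suc (Fin.suc (Fin.suc (Fin.suc Fin.zero)))) = Fin.zero

Consec : Fin 5 → Fin 5 → Set
Consec i j = suc5 i ≡ j ⊎ suc5 j ≡ i

IsInduced5Cycle : ∀ {n} → Graph n → (Fin 5 → Fin n) → Set
IsInduced5Cycle G c =
  Injective _≡_ _≡_ c ×
  (∀ i j → Edge G (c i) (c j) → Consec i j) ×
  (∀ i j → Consec i j → Edge G (c i) (c j))

image5 : ∀ {n} → (Fin 5 → Fin n) → Subset n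
image5 {n} c = tabulate (λ u → anyB (λ i → ⌊ c i ≟ u ⌋))
  where
  anyB : (Fin 5 → Bool) → Bool
  anyB p = not (allB (λ i → not (p i)))

-- C ∈ C_G (identified with its vertex set): an induced 5-cycle of G
-- containing no two adjacent vertices both of degree ≥ 3 in G.
IsBasic5Cycle : ∀ {n} → Graph n → Subset n → Set
IsBasic5Cycle G C = ∃ λ c → IsInduced5Cycle G c ×
  (∀ i j → Edge G (c i) (c j) → ¬ (3 Data.Nat.≤ deg G (c i) × 3 Data.Nat.≤ deg G (c j))) ×
  C ≡ image5 c
  where import Data.Nat

edgeSet : ∀ {n} → Fin n × Fin n → Subset n
edgeSet (b , b') = ⁅ b ⁆ ∪ ⁅ b' ⁆

PropertyP : ∀ {n} → Graph n → Fin n × Fin n → Set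
PropertyP G (b , b') = ∀ a a' → Edge G a b → Edge G a' b' → Edge G a a'

-- Q is a matching of G (a list of edges, pairwise vertex-disjoint;
-- two list positions holding edges with a common vertex are the same position)
-- in which every edge has property (P).
data _⟨_⟩At_ {A : Set} : List A → ℕ → A → Set where
  here  : ∀ {x xs} → (x ∷ xs) ⟨ zero ⟩At x
  there : ∀ {x y xs k} → xs ⟨ k ⟩At y → (x ∷ xs) ⟨ suc k ⟩At y

IsMatchingP : ∀ {n} → Graph n → List (Fin n × Fin n) → Set
IsMatchingP G Q =
  (∀ e → e ∈ₗ Q → Edge G (proj₁ e) (proj₂ e) × PropertyP G e) ×
  (∀ i j e e' → Q ⟨ i ⟩At e → Q ⟨ j ⟩At e' →
     (∃ λ v → v ∈ edgeSet e × v ∈ edgeSet e') → i ≡ j)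

InFamily : ∀ {n} → Graph n → List (Fin n × Fin n) → Subset n → Set
InFamily G Q S = IsSimplex G S ⊎ IsBasic5Cycle G S ⊎ (∃ λ e → e ∈ₗ Q × S ≡ edgeSet e)

IsPartition : ∀ {n} → (Subset n → Set) → Set
IsPartition {n} F =
  (∀ S → F S → ∃ λ v → v ∈ S) ×
  (∀ v → ∃ λ S → F S × v ∈ S) ×
  (∀ v S S' → F S → F S' → v ∈ S → v ∈ S' → S ≡ S')

SCQWitness : ∀ {n} → Graph n → List (Fin n × Fin n) → Set
SCQWitness G Q = IsMatchingP G Q × IsPartition (InFamily G Q)

IsSCQ : ∀ {n} → Graph n → Set
IsSCQ G = ∃ λ Q → SCQWitness G Q

module Submission where

open import Data.Bool using (Bool; true; false; _∨_; not)
open import Data.Bool.Properties using (∨-zeroʳ)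
open import Data.Empty using (⊥-elim)
open import Data.Fin using (Fin; zero; suc; _≟_)
open import Data.Fin.Properties using (any?; all?; ¬∀⟶∃¬)
open import Data.Fin.Subset
open import Data.Fin.Subset.Induction using (⊂-wellFounded; Acc; acc)
open import Data.Fin.Subset.Properties
open import Data.List using (List; map; filter)
open import Data.List.Membership.Propositional using () renaming (_∈_ to _∈ₗ_)
open import Data.List.Membership.Propositional.Properties
  using (∈-map⁺; ∈-map⁻; ∈-filter⁺; ∈-filter⁻; ∈-++⁺ˡ; ∈-++⁺ʳ; foldr-selective)
open import Data.List.Properties using (foldr-preservesᵒ)
import Data.List.Relation.Unary.Any as Any
open import Data.Nat using (ℕ; suc; _+_; _∸_; _⊓_; _≤_; _<_; z≤n; s≤s; s≤s⁻¹)
open import Data.Nat.Properties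
  using (≤-refl; ≤-reflexive; ≤-trans; ≤-antisym; ≤-<-trans; <-irrefl;
         +-mono-≤; +-suc; m∸n≤m; ∸-monoˡ-≤; m≤n⇒m⊓o≤n; m≤n⇒o⊓m≤n; ⊓-sel; module ≤-Reasoning)
open import Data.Product using (∃; _×_; _,_; proj₁; proj₂)
open import Data.Sum using (_⊎_; inj₁; inj₂; [_,_]′)
open import Data.Vec using ([]; _∷_; lookup)
open import Data.Vec.Properties using (lookup∘tabulate; []=⇒lookup; lookup⇒[]=)
open import Function.Bundles using (_⇔_; mk⇔; Equivalence)
open import Relation.Nullary using (¬_; Dec; yes; no)
open import Relation.Nullary.Decidable using (⌊_⌋; _×-dec_; ¬?; dec-true; isYes≗does)
open import Relation.Binary.PropositionalEquality
open import Function.Base using (_∘_; case_of_)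
open import Function.Definitions using (Injective)

open import Defs hiding (sym)
import Defs

-- A minimum vertex cover meets every block of the partition as sparingly as
-- any cover can: a simplex in all but one vertex (otherwise its simplicial
-- vertex could be dropped), an edge with property (P) in one endpoint (outside
-- neighbours of both endpoints would be adjacent, so the edge between them
-- would be uncovered), and a basic 5-cycle in three vertices (four consecutive
-- cycle vertices in the cover include one of degree 2 whose neighbours are all
-- covered, so it could be dropped).  Conversely every cover meets each block at
-- least that often, so a cover attaining these values block by block is, summed
-- over the partition, no larger than a minimum one.

-- Cardinalities of subsets

∣p∣≡∣p∩q∣+∣p∩∁q∣ : ∀ {n} (p q : Subset n) → ∣ p ∣ ≡ ∣ p ∩ q ∣ + ∣ p ∩ ∁ q ∣
∣p∣≡∣p∩q∣+∣p∩∁q∣ []          []          = refl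
∣p∣≡∣p∩q∣+∣p∩∁q∣ (true ∷ p)  (true ∷ q)  = cong suc (∣p∣≡∣p∩q∣+∣p∩∁q∣ p q)
∣p∣≡∣p∩q∣+∣p∩∁q∣ (true ∷ p)  (false ∷ q) = trans (cong suc (∣p∣≡∣p∩q∣+∣p∩∁q∣ p q)) (sym (+-suc _ _))
∣p∣≡∣p∩q∣+∣p∩∁q∣ (false ∷ p) (true ∷ q)  = ∣p∣≡∣p∩q∣+∣p∩∁q∣ p q
∣p∣≡∣p∩q∣+∣p∩∁q∣ (false ∷ p) (false ∷ q) = ∣p∣≡∣p∩q∣+∣p∩∁q∣ p q

module _ {n : ℕ} where

  ∣p∣≤1+∣p∩∁⁅x⁆∣ : ∀ (p : Subset n) x → ∣ p ∣ ≤ suc ∣ p ∩ ∁ ⁅ x ⁆ ∣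
  ∣p∣≤1+∣p∩∁⁅x⁆∣ p x = begin
    ∣ p ∣                           ≡⟨ ∣p∣≡∣p∩q∣+∣p∩∁q∣ p ⁅ x ⁆ ⟩
    ∣ p ∩ ⁅ x ⁆ ∣ + ∣ p ∩ ∁ ⁅ x ⁆ ∣ ≤⟨ +-mono-≤ (∣p∩q∣≤∣q∣ p ⁅ x ⁆) ≤-refl ⟩
    ∣ ⁅ x ⁆ ∣ + ∣ p ∩ ∁ ⁅ x ⁆ ∣     ≡⟨ cong (_+ ∣ p ∩ ∁ ⁅ x ⁆ ∣) (∣⁅x⁆∣≡1 x) ⟩
    suc ∣ p ∩ ∁ ⁅ x ⁆ ∣             ∎
    where open ≤-Reasoning

  x∈p⇒0<∣p∣ : ∀ {x} {p : Subset n} → x ∈ p → 0 < ∣ p ∣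
  x∈p⇒0<∣p∣ x∈p = ≤-<-trans z≤n (x∈p⇒∣p-x∣<∣p∣ x∈p)

  x∈q∧x∉p⇒∣p∩q∣<∣q∣ : ∀ {x} {p q : Subset n} → x ∈ q → x ∉ p → ∣ p ∩ q ∣ < ∣ q ∣
  x∈q∧x∉p⇒∣p∩q∣<∣q∣ {x} {p} {q} x∈q x∉p =
    p⊂q⇒∣p∣<∣q∣ (p∩q⊆q p q , x , x∈q , x∉p ∘ proj₁ ∘ x∈p∩q⁻ p q)

  three∈p⇒3≤∣p∣ : ∀ {x y z} {p : Subset n} → x ≢ y → x ≢ z → y ≢ z →
                  x ∈ p → y ∈ p → z ∈ p → 3 ≤ ∣ p ∣
  three∈p⇒3≤∣p∣ {x} {y} {z} {p} x≢y x≢z y≢z x∈p y∈p z∈p = begin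
    3                 ≤⟨ s≤s (s≤s (x∈p⇒0<∣p∣ z∈p-x-y)) ⟩
    2 + ∣ p - x - y ∣ ≤⟨ s≤s (x∈p⇒∣p-x∣<∣p∣ y∈p-x) ⟩
    1 + ∣ p - x ∣     ≤⟨ x∈p⇒∣p-x∣<∣p∣ x∈p ⟩
    ∣ p ∣             ∎
    where
    open ≤-Reasoning
    y∈p-x : y ∈ p - x
    y∈p-x = x∈p∧x≢y⇒x∈p-y y∈p (x≢y ∘ sym)
    z∈p-x-y : z ∈ p - x - y
    z∈p-x-y = x∈p∧x≢y⇒x∈p-y (x∈p∧x≢y⇒x∈p-y z∈p (x≢z ∘ sym)) (y≢z ∘ sym)

  two∉q⇒2+∣q∩p∣≤∣p∣ : ∀ {x y} {p q : Subset n} → x ≢ y →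
                      x ∈ p → y ∈ p → x ∉ q → y ∉ q → 2 + ∣ q ∩ p ∣ ≤ ∣ p ∣
  two∉q⇒2+∣q∩p∣≤∣p∣ {x} {y} {p} {q} x≢y x∈p y∈p x∉q y∉q = begin
    2 + ∣ q ∩ p ∣     ≤⟨ s≤s (s≤s (p⊆q⇒∣p∣≤∣q∣ q∩p⊆p-x-y)) ⟩
    2 + ∣ p - x - y ∣ ≤⟨ s≤s (x∈p⇒∣p-x∣<∣p∣ y∈p-x) ⟩
    1 + ∣ p - x ∣     ≤⟨ x∈p⇒∣p-x∣<∣p∣ x∈p ⟩
    ∣ p ∣             ∎
    where
    open ≤-Reasoning
    y∈p-x : y ∈ p - x
    y∈p-x = x∈p∧x≢y⇒x∈p-y y∈p (x≢y ∘ sym)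
    q∩p⊆p-x-y : q ∩ p ⊆ p - x - y
    q∩p⊆p-x-y z∈q∩p with x∈p∩q⁻ q p z∈q∩p
    ... | z∈q , z∈p = x∈p∧x≢y⇒x∈p-y (x∈p∧x≢y⇒x∈p-y z∈p λ { refl → x∉q z∈q }) λ { refl → y∉q z∈q }

p⊆range⇒∣p∣≤m : ∀ {m n} {p : Subset n} (f : Fin m → Fin n) →
                (∀ {x} → x ∈ p → ∃ λ i → f i ≡ x) → ∣ p ∣ ≤ m
p⊆range⇒∣p∣≤m {0} {n} {p} f covered =
  ≤-reflexive (trans (cong ∣_∣ (Empty-unique λ (_ , x∈p) → case proj₁ (covered x∈p) of λ ())) (∣⊥∣≡0 n))
p⊆range⇒∣p∣≤m {suc m} {p = p} f covered =
  ≤-trans (∣p∣≤1+∣p∩∁⁅x⁆∣ p (f zero)) (s≤s (p⊆range⇒∣p∣≤m (f ∘ suc) coveredByRest))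
  where
  coveredByRest : ∀ {x} → x ∈ p ∩ ∁ ⁅ f zero ⁆ → ∃ λ i → f (suc i) ≡ x
  coveredByRest x∈ with x∈p∩q⁻ p _ x∈
  ... | x∈p , x∉⁅f0⁆ with covered x∈p
  ... | zero , refl = ⊥-elim (x∈∁p⇒x∉p x∉⁅f0⁆ (x∈⁅x⁆ (f zero)))
  ... | suc i , fi≡x = i , fi≡x

∣p∩edgeSet∣≤1 : ∀ {n} {x y : Fin n} {p : Subset n} → x ∉ p ⊎ y ∉ p → ∣ p ∩ edgeSet (x , y) ∣ ≤ 1
∣p∩edgeSet∣≤1 {x = x} {y} {p} missing = begin
  ∣ p ∩ edgeSet (x , y) ∣ ≤⟨ p⊆q⇒∣p∣≤∣q∣ (⊆-other missing) ⟩
  ∣ ⁅ other missing ⁆ ∣   ≡⟨ ∣⁅x⁆∣≡1 (other missing) ⟩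
  1                       ∎
  where
  open ≤-Reasoning
  other : x ∉ p ⊎ y ∉ p → Fin _
  other (inj₁ _) = y
  other (inj₂ _) = x
  ⊆-other : ∀ m → p ∩ edgeSet (x , y) ⊆ ⁅ other m ⁆
  ⊆-other m z∈ with x∈p∩q⁻ p _ z∈
  ... | z∈p , z∈xy with x∈p∪q⁻ ⁅ x ⁆ ⁅ y ⁆ z∈xy | m
  ... | inj₁ z∈x | inj₁ x∉p = ⊥-elim (x∉p (subst (_∈ p) (x∈⁅y⁆⇒x≡y x z∈x) z∈p))
  ... | inj₂ z∈y | inj₁ _   = z∈y
  ... | inj₁ z∈x | inj₂ _   = z∈x
  ... | inj₂ z∈y | inj₂ y∉p = ⊥-elim (y∉p (subst (_∈ p) (x∈⁅y⁆⇒x≡y y z∈y) z∈p))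

module _ {n} {F : Subset n → Set} (partition : IsPartition F) (A B : Subset n)
         (blockwise : ∀ S → F S → ∣ A ∩ S ∣ ≤ ∣ B ∩ S ∣) where

  private
    UnionOfBlocks : Subset n → Set
    UnionOfBlocks U = ∀ {v} → v ∈ U → ∃ λ S → F S × v ∈ S × S ⊆ U

    sameBlock : ∀ {v S S′} → F S → F S′ → v ∈ S → v ∈ S′ → S ≡ S′
    sameBlock FS FS′ = proj₂ (proj₂ partition) _ _ _ FS FS′

    ∣∩∣≤-on : ∀ U → Acc _⊂_ U → UnionOfBlocks U → ∣ A ∩ U ∣ ≤ ∣ B ∩ U ∣
    ∣∩∣≤-on U (acc smaller) blocks with nonempty? U
    ... | no U-empty = ≤-trans (≤-trans (∣p∩q∣≤∣q∣ A U) (≤-reflexive ∣U∣≡0)) z≤n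
      where
      ∣U∣≡0 : ∣ U ∣ ≡ 0
      ∣U∣≡0 = trans (cong ∣_∣ (Empty-unique U-empty)) (∣⊥∣≡0 n)
    ... | yes (v , v∈U) with blocks v∈U
    ... | S , FS , v∈S , S⊆U = begin
      ∣ A ∩ U ∣           ≡⟨ split A ⟩
      ∣ A ∩ S ∣ + ∣ A ∩ U′ ∣ ≤⟨ +-mono-≤ (blockwise S FS) (∣∩∣≤-on U′ (smaller U′⊂U) blocks′) ⟩
      ∣ B ∩ S ∣ + ∣ B ∩ U′ ∣ ≡⟨ split B ⟨
      ∣ B ∩ U ∣           ∎
      where
      open ≤-Reasoning
      U′ : Subset n
      U′ = U ∩ ∁ S

      U∩S≡S : U ∩ S ≡ S
      U∩S≡S = ⊆-antisym (p∩q⊆q U S) (λ x∈S → x∈p∩q⁺ (S⊆U x∈S , x∈S))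

      split : ∀ X → ∣ X ∩ U ∣ ≡ ∣ X ∩ S ∣ + ∣ X ∩ U′ ∣
      split X = trans (∣p∣≡∣p∩q∣+∣p∩∁q∣ (X ∩ U) S)
        (cong₂ (λ P Q → ∣ P ∣ + ∣ Q ∣) (trans (∩-assoc X U S) (cong (X ∩_) U∩S≡S)) (∩-assoc X U (∁ S)))

      U′⊂U : U′ ⊂ U
      U′⊂U = p∩q⊆p U (∁ S) , v , v∈U , λ v∈U′ → x∈∁p⇒x∉p (proj₂ (x∈p∩q⁻ U _ v∈U′)) v∈S

      blocks′ : UnionOfBlocks U′
      blocks′ w∈U′ with x∈p∩q⁻ U _ w∈U′
      ... | w∈U , w∉S with blocks w∈U
      ... | S′ , FS′ , w∈S′ , S′⊆U = S′ , FS′ , w∈S′ , λ z∈S′ →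
        x∈p∩q⁺ (S′⊆U z∈S′ , x∉p⇒x∈∁p λ z∈S →
          x∈∁p⇒x∉p w∉S (subst (_ ∈_) (sameBlock FS′ FS z∈S′ z∈S) w∈S′))

  ∣∩∣≤-blockwise⇒∣∣≤ : ∣ A ∣ ≤ ∣ B ∣
  ∣∩∣≤-blockwise⇒∣∣≤ = subst₂ _≤_ (cong ∣_∣ (∩-identityʳ A)) (cong ∣_∣ (∩-identityʳ B))
    (∣∩∣≤-on ⊤ (⊂-wellFounded ⊤) λ v∈⊤ →
      let (S , FS , v∈S) = proj₁ (proj₂ partition) _ in S , FS , v∈S , λ _ → ∈⊤)

allB-sound : ∀ {n} (p : Fin n → Bool) → allB p ≡ true → ∀ i → p i ≡ true
allB-sound p h zero with p zero | h
... | true | _ = refl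
allB-sound p h (suc i) with p zero | h
... | true | h′ = allB-sound (λ j → p (suc j)) h′ i

allB-complete : ∀ {n} (p : Fin n → Bool) → (∀ i → p i ≡ true) → allB p ≡ true
allB-complete {0} p h = refl
allB-complete {suc n} p h rewrite h zero = allB-complete (λ j → p (suc j)) (λ j → h (suc j))

allB-false : ∀ {n} (p : Fin n → Bool) i → p i ≡ false → allB p ≡ false
allB-false p i pi≡false with allB p in all
... | false = refl
... | true  = case trans (sym (allB-sound p all i)) pi≡false of λ ()

∈⇔lookup : ∀ {n} {x : Fin n} {p : Subset n} → x ∈ p ⇔ lookup p x ≡ true
∈⇔lookup {x = x} {p} = mk⇔ []=⇒lookup (lookup⇒[]= x p)

isVertexCoverᵇ⇔IsVertexCover : ∀ {n} (G : Graph n) C → isVertexCoverᵇ G C ≡ true ⇔ IsVertexCover G C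
isVertexCoverᵇ⇔IsVertexCover G C = mk⇔ sound complete
  where
  sound : isVertexCoverᵇ G C ≡ true → IsVertexCover G C
  sound h u v e with allB-sound _ (allB-sound _ h u) v
  ... | covered rewrite e with lookup C u in u∈C
  ... | true  = inj₁ (Equivalence.from ∈⇔lookup u∈C)
  ... | false = inj₂ (Equivalence.from ∈⇔lookup covered)

  complete : IsVertexCover G C → isVertexCoverᵇ G C ≡ true
  complete cover = allB-complete _ λ u → allB-complete _ λ v → edgeCovered u v
    where
    edgeCovered : ∀ u v → (not (adj G u v) ∨ lookup C u ∨ lookup C v) ≡ true
    edgeCovered u v with adj G u v in e
    ... | false = refl
    ... | true with cover u v e
    ... | inj₁ u∈C rewrite Equivalence.to ∈⇔lookup u∈C = refl
    ... | inj₂ v∈C rewrite Equivalence.to ∈⇔lookup v∈C = ∨-zeroʳ (lookup C u)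

∈-allSubsets : ∀ {n} (p : Subset n) → p ∈ₗ allSubsets n
∈-allSubsets [] = Any.here refl
∈-allSubsets {suc n} (true ∷ p) = ∈-++⁺ˡ (∈-map⁺ (true ∷_) (∈-allSubsets p))
∈-allSubsets {suc n} (false ∷ p) =
  ∈-++⁺ʳ (map (true ∷_) (allSubsets n)) (∈-map⁺ (false ∷_) (∈-allSubsets p))

module _ {n} (c : Fin 5 → Fin n) where

  c∈image5 : ∀ i → c i ∈ image5 c
  c∈image5 i = Equivalence.from ∈⇔lookup
    (trans (lookup∘tabulate _ (c i)) (cong not (allB-false (λ j → not ⌊ c j ≟ c i ⌋) i hit)))
    where
    hit : not ⌊ c i ≟ c i ⌋ ≡ false
    hit = cong not (trans (isYes≗does (c i ≟ c i)) (dec-true (c i ≟ c i) refl))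

  image5⊆range : ∀ {x} → x ∈ image5 c → ∃ λ i → c i ≡ x
  image5⊆range {x} x∈ with any? (λ i → c i ≟ x)
  ... | yes found = found
  ... | no none = case trans (sym notAll) (cong not (allB-complete _ missed)) of λ ()
    where
    notAll : not (allB (λ i → not ⌊ c i ≟ x ⌋)) ≡ true
    notAll = trans (sym (lookup∘tabulate _ x)) (Equivalence.to ∈⇔lookup x∈)
    missed : ∀ i → not ⌊ c i ≟ x ⌋ ≡ true
    missed i with c i ≟ x
    ... | yes ci≡x = ⊥-elim (none (i , ci≡x))
    ... | no _     = refl

module _ {n} (G : Graph n) where

  private
    coverSizes : List ℕ
    coverSizes = map ∣_∣ (filter (λ C → isVertexCoverᵇ G C Data.Bool.≟ true) (allSubsets n))
      where import Data.Bool

  τ≤∣C∣ : ∀ {C} → IsVertexCover G C → τ G ≤ ∣ C ∣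
  τ≤∣C∣ {C} cover =
    foldr-preservesᵒ ⊓-≤ n coverSizes (inj₂ (Any.map (≤-reflexive ∘ sym) ∣C∣∈coverSizes))
    where
    ⊓-≤ : ∀ x y → x ≤ ∣ C ∣ ⊎ y ≤ ∣ C ∣ → x ⊓ y ≤ ∣ C ∣
    ⊓-≤ x y (inj₁ x≤) = m≤n⇒m⊓o≤n y x≤
    ⊓-≤ x y (inj₂ y≤) = m≤n⇒o⊓m≤n x y≤
    ∣C∣∈coverSizes : ∣ C ∣ ∈ₗ coverSizes
    ∣C∣∈coverSizes = ∈-map⁺ ∣_∣
      (∈-filter⁺ _ (∈-allSubsets C) (Equivalence.from (isVertexCoverᵇ⇔IsVertexCover G C) cover))

  τ-attained : ∃ λ C → IsVertexCover G C × ∣ C ∣ ≡ τ G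
  τ-attained with foldr-selective ⊓-sel n coverSizes
  ... | inj₁ τ≡n = ⊤ , (λ _ _ _ → inj₁ ∈⊤) , trans (∣⊤∣≡n n) (sym τ≡n)
  ... | inj₂ τ∈coverSizes with ∈-map⁻ ∣_∣ τ∈coverSizes
  ... | C , C∈covers , τ≡∣C∣ =
    C , Equivalence.to (isVertexCoverᵇ⇔IsVertexCover G C) (proj₂ (∈-filter⁻ _ {xs = allSubsets n} C∈covers))
      , sym τ≡∣C∣

-- Vertex covers, simplexes and edges with property (P)

module _ {n} (G : Graph n) where

  Edge-sym : ∀ {u v} → Edge G u v → Edge G v u
  Edge-sym {u} {v} = trans (Defs.sym G v u)

  Edge⇒∈N : ∀ {v w} → Edge G v w → w ∈ N_ G v
  Edge⇒∈N {v} {w} e = Equivalence.from ∈⇔lookup (trans (lookup∘tabulate _ w) e)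

  Edge-irrefl : ∀ {u} → ¬ Edge G u u
  Edge-irrefl {u} e with trans (sym e) (irrefl G u)
  ... | ()

  edge? : ∀ u v → Dec (Edge G u v)
  edge? u v = adj G u v Data.Bool.≟ true
    where import Data.Bool

  cover-minus-vertex : ∀ {C x} → IsVertexCover G C →
    (∀ u → Edge G x u → u ∈ C) → IsVertexCover G (C - x)
  cover-minus-vertex {C} {x} cover neighbours u v e with u ≟ x | v ≟ x
  ... | yes refl | _        = inj₂ (x∈p∧x≢y⇒x∈p-y (neighbours v e) λ { refl → Edge-irrefl e })
  ... | no u≢x   | yes refl = inj₁ (x∈p∧x≢y⇒x∈p-y (neighbours u (Edge-sym e)) u≢x)
  ... | no u≢x   | no v≢x   with cover u v e
  ...   | inj₁ u∈C = inj₁ (x∈p∧x≢y⇒x∈p-y u∈C u≢x)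
  ...   | inj₂ v∈C = inj₂ (x∈p∧x≢y⇒x∈p-y v∈C v≢x)

  minimumCover-outsideNeighbour : ∀ {C x} → IsVertexCover G C → ∣ C ∣ ≡ τ G →
    x ∈ C → ∃ λ u → Edge G x u × u ∉ C
  minimumCover-outsideNeighbour {C} {x} cover minimum x∈C
    with any? (λ u → edge? x u ×-dec ¬? (u ∈? C))
  ... | yes found = found
  ... | no none = ⊥-elim (<-irrefl refl (begin-strict
      τ G       ≤⟨ τ≤∣C∣ G (cover-minus-vertex cover neighbours) ⟩
      ∣ C - x ∣ <⟨ x∈p⇒∣p-x∣<∣p∣ x∈C ⟩
      ∣ C ∣     ≡⟨ minimum ⟩
      τ G       ∎))
    where
    open ≤-Reasoning
    neighbours : ∀ u → Edge G x u → u ∈ C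
    neighbours u e with u ∈? C
    ... | yes u∈C = u∈C
    ... | no u∉C  = ⊥-elim (none (u , e , u∉C))

  ∈N[_] : ∀ {u} v → u ≡ v ⊎ Edge G v u → u ∈ N[ v ] G
  ∈N[ v ] (inj₁ refl) = Equivalence.from ∈⇔lookup
    (trans (lookup∘tabulate _ v) (cong (_∨ adj G v v) (trans (isYes≗does (v ≟ v)) (dec-true (v ≟ v) refl))))
  ∈N[_] {u} v (inj₂ e) = Equivalence.from ∈⇔lookup
    (trans (lookup∘tabulate _ u) (trans (cong (⌊ u ≟ v ⌋ ∨_) e) (∨-zeroʳ _)))

  cover-clique-lowerBound : ∀ {D K} → IsVertexCover G D → IsClique G K → ∣ K ∣ ∸ 1 ≤ ∣ D ∩ K ∣
  cover-clique-lowerBound {D} {K} cover clique with any? (λ u → (u ∈? K) ×-dec ¬? (u ∈? D))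
  ... | yes (u , u∈K , u∉D) = ∸-monoˡ-≤ 1 (≤-trans (∣p∣≤1+∣p∩∁⁅x⁆∣ K u) (s≤s (p⊆q⇒∣p∣≤∣q∣ rest⊆D∩K)))
    where
    rest⊆D∩K : K ∩ ∁ ⁅ u ⁆ ⊆ D ∩ K
    rest⊆D∩K w∈ with x∈p∩q⁻ K _ w∈
    ... | w∈K , w∉u with cover _ _ (clique u _ u∈K w∈K λ { refl → x∈∁p⇒x∉p w∉u (x∈⁅x⁆ u) })
    ...   | inj₁ u∈D = ⊥-elim (u∉D u∈D)
    ...   | inj₂ w∈D = x∈p∩q⁺ (w∈D , w∈K)
  ... | no noneMissing = ≤-trans (m∸n≤m ∣ K ∣ 1) (p⊆q⇒∣p∣≤∣q∣ λ w∈K → x∈p∩q⁺ (inD w∈K , w∈K))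
    where
    inD : K ⊆ D
    inD {w} w∈K with w ∈? D
    ... | yes w∈D = w∈D
    ... | no w∉D  = ⊥-elim (noneMissing (w , w∈K , w∉D))

  minimumCover-misses-simplex : ∀ {C K} → IsVertexCover G C → ∣ C ∣ ≡ τ G →
    IsSimplex G K → ∃ λ u → u ∈ K × u ∉ C
  minimumCover-misses-simplex {C} cover minimum (v , _ , refl) with v ∈? C
  ... | no v∉C  = v , ∈N[ v ] (inj₁ refl) , v∉C
  ... | yes v∈C with minimumCover-outsideNeighbour cover minimum v∈C
  ...   | u , e , u∉C = u , ∈N[ v ] (inj₂ e) , u∉C

  minimumCover-simplex : ∀ {C K} → IsVertexCover G C → ∣ C ∣ ≡ τ G →
    IsSimplex G K → ∣ C ∩ K ∣ ≡ ∣ K ∣ ∸ 1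
  minimumCover-simplex cover minimum simplex@(_ , simplicial , refl)
    with minimumCover-misses-simplex cover minimum simplex
  ... | u , u∈K , u∉C =
    ≤-antisym (∸-monoˡ-≤ 1 (x∈q∧x∉p⇒∣p∩q∣<∣q∣ u∈K u∉C)) (cover-clique-lowerBound cover simplicial)

  cover-edge-lowerBound : ∀ {D b b′} → IsVertexCover G D → Edge G b b′ → 1 ≤ ∣ D ∩ edgeSet (b , b′) ∣
  cover-edge-lowerBound {D} {b} {b′} cover e with cover b b′ e
  ... | inj₁ b∈D  = x∈p⇒0<∣p∣ (x∈p∩q⁺ (b∈D , x∈p∪q⁺ (inj₁ (x∈⁅x⁆ b))))
  ... | inj₂ b′∈D = x∈p⇒0<∣p∣ (x∈p∩q⁺ (b′∈D , x∈p∪q⁺ (inj₂ (x∈⁅x⁆ b′))))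

  -- Outside neighbours of b and of b′ would be adjacent by (P), and that edge would be uncovered.
  minimumCover-propertyP : ∀ {C b b′} → IsVertexCover G C → ∣ C ∣ ≡ τ G →
    PropertyP G (b , b′) → b ∉ C ⊎ b′ ∉ C
  minimumCover-propertyP {C} {b} {b′} cover minimum P with b ∈? C | b′ ∈? C
  ... | no b∉C  | _        = inj₁ b∉C
  ... | yes _   | no b′∉C  = inj₂ b′∉C
  ... | yes b∈C | yes b′∈C
    with minimumCover-outsideNeighbour cover minimum b∈C | minimumCover-outsideNeighbour cover minimum b′∈C
  ...   | x , bx , x∉C | y , b′y , y∉C with cover x y (P x y (Edge-sym bx) (Edge-sym b′y))
  ...     | inj₁ x∈C = ⊥-elim (x∉C x∈C)
  ...     | inj₂ y∈C = ⊥-elim (y∉C y∈C)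

  minimumCover-propertyP-edge : ∀ {C b b′} → IsVertexCover G C → ∣ C ∣ ≡ τ G →
    Edge G b b′ → PropertyP G (b , b′) → ∣ C ∩ edgeSet (b , b′) ∣ ≡ 1
  minimumCover-propertyP-edge cover minimum e P =
    ≤-antisym (∣p∩edgeSet∣≤1 (minimumCover-propertyP cover minimum P)) (cover-edge-lowerBound cover e)

-- Basic 5-cycles

infix 30 _⁺
_⁺ : Fin 5 → Fin 5
_⁺ = suc5

⁺-period : ∀ i → i ⁺ ⁺ ⁺ ⁺ ⁺ ≡ i
⁺-period zero                         = refl
⁺-period (suc zero)                   = refl
⁺-period (suc (suc zero))             = refl
⁺-period (suc (suc (suc zero)))       = refl
⁺-period (suc (suc (suc (suc zero)))) = refl

i⁺≢i : ∀ i → i ⁺ ≢ i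
i⁺≢i zero                         ()
i⁺≢i (suc zero)                   ()
i⁺≢i (suc (suc zero))             ()
i⁺≢i (suc (suc (suc zero)))       ()
i⁺≢i (suc (suc (suc (suc zero)))) ()

i⁺⁺≢i : ∀ i → i ⁺ ⁺ ≢ i
i⁺⁺≢i zero                         ()
i⁺⁺≢i (suc zero)                   ()
i⁺⁺≢i (suc (suc zero))             ()
i⁺⁺≢i (suc (suc (suc zero)))       ()
i⁺⁺≢i (suc (suc (suc (suc zero)))) ()

i⁺⁺⁺≢i : ∀ i → i ⁺ ⁺ ⁺ ≢ i
i⁺⁺⁺≢i zero                         ()
i⁺⁺⁺≢i (suc zero)                   ()
i⁺⁺⁺≢i (suc (suc zero))             ()
i⁺⁺⁺≢i (suc (suc (suc zero)))       ()
i⁺⁺⁺≢i (suc (suc (suc (suc zero)))) ()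

module _ {n} (G : Graph n) {c : Fin 5 → Fin n} (c-injective : Injective _≡_ _≡_ c)
         (c-cycle : ∀ i → Edge G (c i) (c (i ⁺))) where

  private
    c-≢ : ∀ {i j} → i ≢ j → c i ≢ c j
    c-≢ i≢j = i≢j ∘ c-injective

    ∈D⇒∈D∩C₅ : ∀ {D i} → c i ∈ D → c i ∈ D ∩ image5 c
    ∈D⇒∈D∩C₅ {i = i} ci∈D = x∈p∩q⁺ (ci∈D , c∈image5 c i)

    coverSuccessor : ∀ {D j} → IsVertexCover G D → c j ∉ D → c (j ⁺) ∈ D
    coverSuccessor {j = j} cover cj∉D with cover _ _ (c-cycle j)
    ... | inj₁ cj∈D = ⊥-elim (cj∉D cj∈D)
    ... | inj₂ cj⁺∈D = cj⁺∈D

    coverPredecessor : ∀ {D j} → IsVertexCover G D → c j ∉ D → c (j ⁺ ⁺ ⁺ ⁺) ∈ D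
    coverPredecessor {j = j} cover cj∉D with cover _ _ (c-cycle (j ⁺ ⁺ ⁺ ⁺))
    ... | inj₁ cj⁴∈D = cj⁴∈D
    ... | inj₂ cj⁵∈D = ⊥-elim (cj∉D (subst (λ i → c i ∈ _) (⁺-period j) cj⁵∈D))

  -- Around a vertex c j outside D, its cycle neighbours c k (k = j ⁺) and c (k ⁺ ⁺ ⁺) lie in D,
  -- and so does an end of the opposite edge from c (k ⁺) to c (k ⁺ ⁺).
  cover-5cycle-lowerBound : ∀ {D} → IsVertexCover G D → 3 ≤ ∣ D ∩ image5 c ∣
  cover-5cycle-lowerBound {D} cover with all? (λ j → c j ∈? D)
  ... | yes inD = three∈p⇒3≤∣p∣ (c-≢ (λ ())) (c-≢ (λ ())) (c-≢ (λ ()))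
      (∈D⇒∈D∩C₅ (inD zero)) (∈D⇒∈D∩C₅ (inD (suc zero))) (∈D⇒∈D∩C₅ (inD (suc (suc zero))))
  ... | no notAll with ¬∀⟶∃¬ 5 _ (λ j → c j ∈? D) notAll
  ...   | j , cj∉D =
    [ meets (i⁺≢i k ∘ sym) (i⁺⁺≢i (k ⁺) ∘ sym) , meets (i⁺⁺≢i k ∘ sym) (i⁺≢i (k ⁺ ⁺) ∘ sym) ]′
      (cover _ _ (c-cycle (k ⁺)))
    where
    k : Fin 5
    k = j ⁺
    meets : ∀ {m} → k ≢ m → m ≢ k ⁺ ⁺ ⁺ → c m ∈ D → 3 ≤ ∣ D ∩ image5 c ∣
    meets k≢m m≢k³ cm∈D = three∈p⇒3≤∣p∣ (c-≢ k≢m) (c-≢ (i⁺⁺⁺≢i k ∘ sym)) (c-≢ m≢k³)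
      (∈D⇒∈D∩C₅ (coverSuccessor cover cj∉D)) (∈D⇒∈D∩C₅ cm∈D) (∈D⇒∈D∩C₅ (coverPredecessor cover cj∉D))

  two∉D⇒∣D∩C₅∣≤3 : ∀ {D j m} → j ≢ m → c j ∉ D → c m ∉ D → ∣ D ∩ image5 c ∣ ≤ 3
  two∉D⇒∣D∩C₅∣≤3 j≢m cj∉D cm∉D = s≤s⁻¹ (s≤s⁻¹ (≤-trans
    (two∉q⇒2+∣q∩p∣≤∣p∣ (c-≢ j≢m) (c∈image5 c _) (c∈image5 c _) cj∉D cm∉D)
    (p⊆range⇒∣p∣≤m c (image5⊆range c))))

  minimumCover-cycleRun⇒3≤deg : ∀ {C i} → IsVertexCover G C → ∣ C ∣ ≡ τ G →
    c i ∈ C → c (i ⁺) ∈ C → c (i ⁺ ⁺) ∈ C → 3 ≤ deg G (c (i ⁺))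
  minimumCover-cycleRun⇒3≤deg {C} {i} cover minimum ci∈C ci⁺∈C ci⁺⁺∈C
    with minimumCover-outsideNeighbour G cover minimum ci⁺∈C
  ... | u , e , u∉C = three∈p⇒3≤∣p∣ (c-≢ (i⁺⁺≢i i ∘ sym)) (λ { refl → u∉C ci∈C }) (λ { refl → u∉C ci⁺⁺∈C })
      (Edge⇒∈N G (Edge-sym G (c-cycle i))) (Edge⇒∈N G (c-cycle (i ⁺))) (Edge⇒∈N G e)

  module _ (basic : ∀ i → ¬ (3 ≤ deg G (c i) × 3 ≤ deg G (c (i ⁺))))
           {C} (cover : IsVertexCover G C) (minimum : ∣ C ∣ ≡ τ G) where

    minimumCover-noFourInARun : ∀ k → c k ∈ C → c (k ⁺) ∈ C → c (k ⁺ ⁺) ∈ C → c (k ⁺ ⁺ ⁺) ∈ C → Data.Empty.⊥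
    minimumCover-noFourInARun k ck ck⁺ ck⁺⁺ ck⁺⁺⁺ =
      basic (k ⁺) (minimumCover-cycleRun⇒3≤deg cover minimum ck ck⁺ ck⁺⁺ ,
                   minimumCover-cycleRun⇒3≤deg cover minimum ck⁺ ck⁺⁺ ck⁺⁺⁺)

    -- Some c j is missing, its neighbours are in C, and c (j ⁺ ⁺), c (j ⁺ ⁺ ⁺) are not both in C
    -- (that would be four in a run), so two cycle vertices are missing.
    minimumCover-basic5Cycle-upperBound : ∣ C ∩ image5 c ∣ ≤ 3
    minimumCover-basic5Cycle-upperBound with all? (λ j → c j ∈? C)
    ... | yes inC = ⊥-elim (minimumCover-noFourInARun zero (inC _) (inC _) (inC _) (inC _))
    ... | no notAll with ¬∀⟶∃¬ 5 _ (λ j → c j ∈? C) notAll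
    ...   | j , cj∉C with c (j ⁺ ⁺) ∈? C | c (j ⁺ ⁺ ⁺) ∈? C
    ...     | yes cj²∈C | yes cj³∈C = ⊥-elim (minimumCover-noFourInARun (j ⁺)
                (coverSuccessor cover cj∉C) cj²∈C cj³∈C (coverPredecessor cover cj∉C))
    ...     | no cj²∉C  | _         = two∉D⇒∣D∩C₅∣≤3 (i⁺⁺≢i j ∘ sym) cj∉C cj²∉C
    ...     | yes _     | no cj³∉C  = two∉D⇒∣D∩C₅∣≤3 (i⁺⁺⁺≢i j ∘ sym) cj∉C cj³∉C

module _ {n} (G : Graph n) where

  private
    cycleEdges : ∀ {c} → IsInduced5Cycle G c → ∀ i → Edge G (c i) (c (i ⁺))
    cycleEdges (_ , _ , consecutive) i = consecutive i (i ⁺) (inj₁ refl)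

  cover-basic5Cycle-lowerBound : ∀ {D K} → IsVertexCover G D → IsBasic5Cycle G K → 3 ≤ ∣ D ∩ K ∣
  cover-basic5Cycle-lowerBound cover (_ , induced , _ , refl) =
    cover-5cycle-lowerBound G (proj₁ induced) (cycleEdges induced) cover

  minimumCover-basic5Cycle : ∀ {C K} → IsVertexCover G C → ∣ C ∣ ≡ τ G → IsBasic5Cycle G K → ∣ C ∩ K ∣ ≡ 3
  minimumCover-basic5Cycle cover minimum (_ , induced , basic , refl) = ≤-antisym
    (minimumCover-basic5Cycle-upperBound G (proj₁ induced) (cycleEdges induced)
      (λ i → basic i (i ⁺) (cycleEdges induced i)) cover minimum)
    (cover-5cycle-lowerBound G (proj₁ induced) (cycleEdges induced) cover)

-- The blocks of an SCQ partition

MeetsBlocksMinimally : ∀ {n} → Graph n → List (Fin n × Fin n) → Subset n → Set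
MeetsBlocksMinimally G Q C =
  (∀ K → IsSimplex G K → ∣ C ∩ K ∣ ≡ ∣ K ∣ ∸ 1) ×
  (∀ K → IsBasic5Cycle G K → ∣ C ∩ K ∣ ≡ 3) ×
  (∀ e → e ∈ₗ Q → ∣ C ∩ edgeSet e ∣ ≡ 1)

module _ {n} (G : Graph n) (Q : List (Fin n × Fin n)) (matching : IsMatchingP G Q) where

  minimumCover-meetsBlocksMinimally : ∀ {C} → IsVertexCover G C → ∣ C ∣ ≡ τ G → MeetsBlocksMinimally G Q C
  minimumCover-meetsBlocksMinimally cover minimum =
      (λ _ simplex → minimumCover-simplex G cover minimum simplex)
    , (λ _ cycle → minimumCover-basic5Cycle G cover minimum cycle)
    , (λ e e∈Q → let (edge , P) = proj₁ matching e e∈Q in minimumCover-propertyP-edge G cover minimum edge P)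

  meetsBlocksMinimally⇒∣∩∣≤cover : ∀ {C D S} → MeetsBlocksMinimally G Q C → IsVertexCover G D →
    InFamily G Q S → ∣ C ∩ S ∣ ≤ ∣ D ∩ S ∣
  meetsBlocksMinimally⇒∣∩∣≤cover {D = D} (simplexValue , _ , _) cover (inj₁ simplex@(_ , simplicial , refl)) =
    subst (_≤ ∣ D ∩ _ ∣) (sym (simplexValue _ simplex)) (cover-clique-lowerBound G cover simplicial)
  meetsBlocksMinimally⇒∣∩∣≤cover {D = D} (_ , cycleValue , _) cover (inj₂ (inj₁ cycle)) =
    subst (_≤ ∣ D ∩ _ ∣) (sym (cycleValue _ cycle)) (cover-basic5Cycle-lowerBound G cover cycle)
  meetsBlocksMinimally⇒∣∩∣≤cover {D = D} (_ , _ , edgeValue) cover (inj₂ (inj₂ (e , e∈Q , refl))) =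
    subst (_≤ ∣ D ∩ _ ∣) (sym (edgeValue e e∈Q)) (cover-edge-lowerBound G cover (proj₁ (proj₁ matching e e∈Q)))

lemma4p7 : ∀ {n} (D : WOGraph n) (Q : List (Fin n × Fin n)) →
    SCQWitness (WOGraph.graph D) Q →
    (C : Subset n) → IsVertexCover (WOGraph.graph D) C →
    (∣ C ∣ ≡ τ (WOGraph.graph D)) ⇔
      ((∀ K → IsSimplex (WOGraph.graph D) K → ∣ C ∩ K ∣ ≡ ∣ K ∣ ∸ 1) ×
       (∀ K → IsBasic5Cycle (WOGraph.graph D) K → ∣ C ∩ K ∣ ≡ 3) ×
       (∀ e → e ∈ₗ Q → ∣ C ∩ edgeSet e ∣ ≡ 1))
lemma4p7 D Q (matching , partition) C cover =
  mk⇔ (minimumCover-meetsBlocksMinimally G Q matching cover) attainsτ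
  where
  G : Graph _
  G = WOGraph.graph D

  attainsτ : MeetsBlocksMinimally G Q C → ∣ C ∣ ≡ τ G
  attainsτ meets with τ-attained G
  ... | C₀ , cover₀ , minimum₀ = ≤-antisym (begin
      ∣ C ∣  ≤⟨ ∣∩∣≤-blockwise⇒∣∣≤ partition C C₀ (λ _ →
                  meetsBlocksMinimally⇒∣∩∣≤cover G Q matching {C} meets cover₀) ⟩
      ∣ C₀ ∣ ≡⟨ minimum₀ ⟩
      τ G    ∎)
    (τ≤∣C∣ G cover)
    where open ≤-Reasoning
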